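{- Let $A=\{a,b\}$ and $A^{\mathbb N}_{\mathrm{cl}}$ the set of infinite words over $A$ closed under reversal. Then $\mathit{MinPal}(A^{\mathbb N}_{\mathrm{cl}})\le 13$.
   Context: $\mathit{MinPal}(X)=\inf\{\#\mathrm{PAL}(\omega)\mid\omega\in X\}$, where $\mathrm{PAL}(\omega)$ is the set of palindromic factors of $\omega$ including the empty word. Closed under reversal: the reversal of every factor is a factor. -}

module Defs where

open import Data.Nat using (ℕ; zero; suc; _+_; _≤_)
open import Data.List using (List; []; _∷_; reverse; length)
open import Data.List.Membership.Propositional using (_∈_)
open import Data.Product using (Σ; ∃; _×_)
open import Relation.Binary.PropositionalEquality using (_≡_)

data A : Set where
  a b : A

InfWord : Set
InfWord = ℕ → A

window : InfWord → ℕ → ℕ → List A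
window ω i zero    = []
window ω i (suc n) = ω i ∷ window ω (suc i) n

Factor : List A → InfWord → Set
Factor u ω = ∃ λ i → window ω i (length u) ≡ u

Palindrome : List A → Set
Palindrome u = reverse u ≡ u

ClosedUnderReversal : InfWord → Set
ClosedUnderReversal ω = ∀ u → Factor u ω → Factor (reverse u) ω

-- #PAL(ω) ≤ k : the set of palindromic factors (including the empty word)
-- is covered by a list of at most k words, i.e. it has at most k elements.
PalCountAtMost : InfWord → ℕ → Set
PalCountAtMost ω k =
  Σ (List (List A)) λ L → (length L ≤ k) × (∀ u → Factor u ω → Palindrome u → u ∈ L)

-- The witness is ω = B₀ B₁ B₂ …, where the 14-letter block Bₖ is a core of 12 letters followed by a
-- hinge of 2 letters. The core is aabbabaaabba or its reversal, according to the parity of k; the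
-- hinge is ab or ba, according to the k-th term of the regular paperfolding sequence.
--
-- Closure under reversal: for every m, reflecting the first 14(2ᵐ − 1) positions about the centre
-- c = 14(2ᵐ⁺¹ − 1) + 11 maps ω to itself. Cores are exchanged with cores of the opposite parity,
-- hence reversed; hinges are exchanged with hinges at indices k ↔ 2(2ᵐ − 1) − k, where the
-- paperfolding sequence takes complementary values, hence also reversed. So every prefix of ω, and
-- thus every factor, reappears reversed.
--
-- Palindromes: every factor of length at most 8 lies inside some core–hinge–core word, and a direct
-- check of these four words shows that such palindromic factors are among 13 words, none longer than
-- 6. Since deleting both end letters of a palindrome leaves a palindrome, ω has no longer ones.
module Submission where

open import Defs
open import Data.Bool using (Bool; true; false; not; _xor_)
open import Data.Bool.Properties using (not-involutive; xor-identityʳ)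
open import Data.Fin using (Fin; toℕ; opposite; _↑ˡ_; _↑ʳ_; splitAt)
open import Data.Fin.Properties
  using (all?; toℕ<n; toℕ-injective; toℕ-fromℕ<; opposite-prop; toℕ-↑ˡ; toℕ-↑ʳ; splitAt⁻¹-↑ˡ; splitAt⁻¹-↑ʳ)
open import Data.List using (List; []; _∷_; _++_; _∷ʳ_; reverse; length; take; drop)
open import Data.List.Properties
  using (≡-dec; unfold-reverse; reverse-++; ∷ʳ-injectiveˡ; ∷-injectiveʳ; length-reverse)
open import Data.List.Relation.Unary.All as All using (All)
open import Data.Nat
  using (ℕ; zero; suc; _+_; _*_; _∸_; _⊔_; _≤_; _<_; _≤′_; ≤′-refl; ≤′-step; z≤n; s≤s; s≤s⁻¹; NonZero; allUpTo?)
open import Data.Nat.Properties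
open import Data.Nat.DivMod
  using (_/_; _%_; _mod_; m≡m%n+[m/n]*n; m%n<n; +-distrib-/; m*n%n≡0; m*n/n≡m; m<n⇒m/n≡0; %-remove-+ˡ;
         m<n⇒m%n≡m; m<n*o⇒m/o<n)
open import Data.Nat.Divisibility using (n∣m*n)
open import Algebra.Properties.CommutativeSemigroup +-commutativeSemigroup using (interchange)
open import Data.Product using (Σ; ∃; _×_; _,_)
open import Data.Sum using (inj₁; inj₂)
open import Data.Vec using (Vec; []; _∷_; lookup; toList)
  renaming (_++_ to _++ᵛ_)
open import Data.Vec.Properties using (lookup-++ˡ; lookup-++ʳ)
open import Function using (_∘_)
open import Relation.Binary using (DecidableEquality; tri<; tri≈; tri>)
open import Relation.Binary.PropositionalEquality
open import Relation.Nullary using (Dec; yes; no; contradiction)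
open import Relation.Nullary.Decidable using (from-yes; _→-dec_)
open ≡-Reasoning

_≟A_ : DecidableEquality A
a ≟A a = yes refl
a ≟A b = no λ ()
b ≟A a = no λ ()
b ≟A b = yes refl

open import Data.List.Membership.DecPropositional (≡-dec _≟A_) using (_∈_; _∈?_)

palindrome? : ∀ v → Dec (Palindrome v)
palindrome? v = ≡-dec _≟A_ (reverse v) v

module _ (ω : InfWord) where

  window-++ : ∀ i m n → window ω i (m + n) ≡ window ω i m ++ window ω (i + m) n
  window-++ i zero    n rewrite +-identityʳ i = refl
  window-++ i (suc m) n rewrite +-suc i m = cong (ω i ∷_) (window-++ (suc i) m n)

  window-∷ʳ : ∀ i n → window ω i (suc n) ≡ window ω i n ∷ʳ ω (i + n)
  window-∷ʳ i n = trans (cong (window ω i) (+-comm 1 n)) (window-++ i n 1)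

  length-window : ∀ i n → length (window ω i n) ≡ n
  length-window i zero    = refl
  length-window i (suc n) = cong suc (length-window (suc i) n)

  take-window : ∀ i {m n} → n ≤ m → take n (window ω i m) ≡ window ω i n
  take-window i {n = zero}  _         = refl
  take-window i {n = suc n} (s≤s n≤m) = cong (ω i ∷_) (take-window (suc i) n≤m)

  drop-window : ∀ i r m → drop r (window ω i m) ≡ window ω (i + r) (m ∸ r)
  drop-window i zero    m       rewrite +-identityʳ i = refl
  drop-window i (suc r) zero    = refl
  drop-window i (suc r) (suc m) rewrite +-suc i r = drop-window (suc i) r m

  window-infix : ∀ i r {m n} → r + n ≤ m → window ω (i + r) n ≡ take n (drop r (window ω i m))
  window-infix i r {m} {n} r+n≤m = begin
    window ω (i + r) n                  ≡⟨ take-window (i + r) n≤m∸r ⟨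
    take n (window ω (i + r) (m ∸ r))   ≡⟨ cong (take n) (drop-window i r m) ⟨
    take n (drop r (window ω i m))      ∎
    where
    n≤m∸r : n ≤ m ∸ r
    n≤m∸r = subst (_≤ m ∸ r) (m+n∸m≡n r n) (∸-monoˡ-≤ r r+n≤m)

  window-lookup : ∀ i {n} (v : Vec A n) → (∀ r → ω (i + toℕ r) ≡ lookup v r) → window ω i n ≡ toList v
  window-lookup i []      _      = refl
  window-lookup i (x ∷ v) agree = cong₂ _∷_
    (trans (cong ω (sym (+-identityʳ i))) (agree Fin.zero))
    (window-lookup (suc i) v λ r → trans (cong ω (sym (+-suc i (toℕ r)))) (agree (Fin.suc r)))

  palindrome-inner : ∀ i n → Palindrome (window ω i (2 + n)) → Palindrome (window ω (suc i) n)
  palindrome-inner i n pal = ∷ʳ-injectiveˡ _ _ (∷-injectiveʳ (begin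
    last ∷ (reverse inner ∷ʳ ω i)     ≡⟨ cong (_∷ʳ ω i) (reverse-++ inner (last ∷ [])) ⟨
    reverse (inner ∷ʳ last) ∷ʳ ω i    ≡⟨ unfold-reverse (ω i) (inner ∷ʳ last) ⟨
    reverse (ω i ∷ (inner ∷ʳ last))   ≡⟨ cong reverse outer ⟨
    reverse (window ω i (2 + n))      ≡⟨ pal ⟩
    window ω i (2 + n)                ≡⟨ outer ⟩
    ω i ∷ (inner ∷ʳ last)             ∎))
    where
    inner = window ω (suc i) n
    last  = ω (suc i + n)
    outer : window ω i (2 + n) ≡ ω i ∷ (inner ∷ʳ last)
    outer = cong (ω i ∷_) (window-∷ʳ (suc i) n)

  palindromes-from-short : ∀ (L : List (List A)) n → All (λ v → 2 + length v ≤ n) L →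
    (∀ i m → m ≤ n → Palindrome (window ω i m) → window ω i m ∈ L) →
    ∀ i m → Palindrome (window ω i m) → window ω i m ∈ L
  palindromes-from-short L n short base i m pal with m ≤? n
  ... | yes m≤n = base i m m≤n pal
  palindromes-from-short L n short base i zero          pal | no m≰n = contradiction z≤n m≰n
  -- The empty palindrome lies in L, so n ≥ 2.
  palindromes-from-short L n short base i (suc zero)    pal | no m≰n =
    contradiction (≤-trans (s≤s z≤n) (All.lookup short (base i 0 z≤n refl))) m≰n
  palindromes-from-short L n short base i (suc (suc m)) pal | no m≰n =
    contradiction (subst (λ l → 2 + l ≤ n) (length-window (suc i) m) (All.lookup short inner∈L)) m≰n
    where
    inner∈L = palindromes-from-short L n short base (suc i) m (palindrome-inner i m pal)

  reverse-window : ∀ c i n → i + n ≤ c → (∀ t → t < i + n → ω (c ∸ t) ≡ ω t) →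
    reverse (window ω i n) ≡ window ω (suc c ∸ (i + n)) n
  reverse-window c i zero    _     _      = refl
  reverse-window c i (suc n) i+1+n≤c mirror = begin
    reverse (window ω i (suc n))                     ≡⟨ cong reverse (window-∷ʳ i n) ⟩
    reverse (window ω i n ∷ʳ ω (i + n))              ≡⟨ reverse-++ (window ω i n) _ ⟩
    ω (i + n) ∷ reverse (window ω i n)               ≡⟨ cong₂ _∷_ (sym (mirror (i + n) i+n<i+1+n))
                                                          (reverse-window c i n (<⇒≤ i+n<c) mirror′) ⟩
    ω (c ∸ (i + n)) ∷ window ω (suc c ∸ (i + n)) n   ≡⟨ cong (λ j → ω (c ∸ (i + n)) ∷ window ω j n)
                                                          (+-∸-assoc 1 (<⇒≤ i+n<c)) ⟩
    window ω (c ∸ (i + n)) (suc n)                   ≡⟨ cong (λ j → window ω (suc c ∸ j) (suc n)) (+-suc i n) ⟨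
    window ω (suc c ∸ (i + suc n)) (suc n)           ∎
    where
    i+n<i+1+n : i + n < i + suc n
    i+n<i+1+n = +-monoʳ-< i ≤-refl
    i+n<c : i + n < c
    i+n<c = subst (_≤ c) (+-suc i n) i+1+n≤c
    mirror′ : ∀ t → t < i + n → ω (c ∸ t) ≡ ω t
    mirror′ t t<i+n = mirror t (<-trans t<i+n i+n<i+1+n)

  closedUnderReversal : (∀ m → ∃ λ c → m ≤ c × (∀ t → t < m → ω (c ∸ t) ≡ ω t)) → ClosedUnderReversal ω
  closedUnderReversal mirrors u (i , eq) with mirrors (i + length u)
  ... | c , bound , mirror = j , (begin
    window ω j (length (reverse u))   ≡⟨ cong (window ω j) (length-reverse u) ⟩
    window ω j (length u)             ≡⟨ reverse-window c i (length u) bound mirror ⟨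
    reverse (window ω i (length u))   ≡⟨ cong reverse eq ⟩
    reverse u                         ∎)
    where j = suc c ∸ (i + length u)

module _ {n} .{{_ : NonZero n}} (k : ℕ) (i : Fin n) where

  [k*n+i]/n≡k : (k * n + toℕ i) / n ≡ k
  [k*n+i]/n≡k = begin
    (k * n + toℕ i) / n     ≡⟨ +-distrib-/ (k * n) (toℕ i) remainders<n ⟩
    k * n / n + toℕ i / n   ≡⟨ cong₂ _+_ (m*n/n≡m k n) (m<n⇒m/n≡0 (toℕ<n i)) ⟩
    k + 0                   ≡⟨ +-identityʳ k ⟩
    k                       ∎
    where
    remainders<n : k * n % n + toℕ i % n < n
    remainders<n = subst (λ r → r + toℕ i % n < n) (sym (m*n%n≡0 k n)) (m%n<n (toℕ i) n)

  [k*n+i]mod-n≡i : (k * n + toℕ i) mod n ≡ i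
  [k*n+i]mod-n≡i = toℕ-injective (begin
    toℕ ((k * n + toℕ i) mod n)   ≡⟨ toℕ-fromℕ< _ ⟩
    (k * n + toℕ i) % n           ≡⟨ %-remove-+ˡ (toℕ i) (n∣m*n k) ⟩
    toℕ i % n                     ≡⟨ m<n⇒m%n≡m (toℕ<n i) ⟩
    toℕ i                         ∎)

m≡[m/n]*n+m-mod-n : ∀ m n .{{_ : NonZero n}} → m ≡ m / n * n + toℕ (m mod n)
m≡[m/n]*n+m-mod-n m n = begin
  m                           ≡⟨ m≡m%n+[m/n]*n m n ⟩
  m % n + m / n * n           ≡⟨ +-comm (m % n) _ ⟩
  m / n * n + m % n           ≡⟨ cong (m / n * n +_) (toℕ-fromℕ< _) ⟨
  m / n * n + toℕ (m mod n)   ∎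

toℕ-+-opposite : ∀ {n} (i : Fin (suc n)) → toℕ i + toℕ (opposite i) ≡ n
toℕ-+-opposite i = trans (cong (toℕ i +_) (opposite-prop i)) (m+[n∸m]≡n (s≤s⁻¹ (toℕ<n i)))

mirror-position : ∀ n {M k i j d} → i + j ≡ d → k ≤ M → M * n + d ∸ (k * n + i) ≡ (M ∸ k) * n + j
mirror-position n {M} {k} {i} {j} {d} i+j≡d k≤M = begin
  M * n + d ∸ (k * n + i)                          ≡⟨ cong (_∸ (k * n + i)) sum ⟨
  ((M ∸ k) * n + j) + (k * n + i) ∸ (k * n + i)    ≡⟨ m+n∸n≡m _ (k * n + i) ⟩
  (M ∸ k) * n + j                                  ∎
  where
  sum : ((M ∸ k) * n + j) + (k * n + i) ≡ M * n + d
  sum = begin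
    ((M ∸ k) * n + j) + (k * n + i)   ≡⟨ interchange ((M ∸ k) * n) j (k * n) i ⟩
    ((M ∸ k) * n + k * n) + (j + i)   ≡⟨ cong₂ _+_ (*-distribʳ-+ n (M ∸ k) k) (+-comm i j) ⟨
    (M ∸ k + k) * n + (i + j)         ≡⟨ cong₂ (λ x y → x * n + y) (m∸n+n≡m k≤M) i+j≡d ⟩
    M * n + d                         ∎

odd : ℕ → Bool
odd zero    = false
odd (suc n) = not (odd n)

not-xor-not : ∀ x y → not x xor not y ≡ x xor y
not-xor-not true  y = refl
not-xor-not false y = not-involutive y

odd-∸ : ∀ {k n} → k ≤ n → odd (n ∸ k) ≡ odd n xor odd k
odd-∸ {n = n} z≤n               = sym (xor-identityʳ (odd n))
odd-∸ {suc k} {suc n} (s≤s k≤n) = trans (odd-∸ k≤n) (sym (not-xor-not (odd n) (odd k)))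

odd-double : ∀ n → odd (n + n) ≡ false
odd-double zero    = refl
odd-double (suc n) = begin
  not (odd (n + suc n))     ≡⟨ cong (not ∘ odd) (+-suc n n) ⟩
  not (not (odd (n + n)))   ≡⟨ not-involutive _ ⟩
  odd (n + n)               ≡⟨ odd-double n ⟩
  false                     ∎

foldLength : ℕ → ℕ
foldLength zero    = zero
foldLength (suc m) = suc (foldLength m + foldLength m)

-- folding m agrees with the paperfolding sequence on [0, 2ᵐ − 1): the creases after m + 1 folds are
-- those after m folds, a middle crease, then the earlier ones mirrored and complemented.
folding : ℕ → ℕ → Bool
folding zero    k = false
folding (suc m) k with <-cmp k (foldLength m)
... | tri< _ _ _ = folding m k
... | tri≈ _ _ _ = true
... | tri> _ _ _ = not (folding m (foldLength m + foldLength m ∸ k))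

paperfolding : ℕ → Bool
paperfolding k = folding (suc k) k

foldLength-mono : ∀ {m n} → m ≤ n → foldLength m ≤ foldLength n
foldLength-mono z≤n       = z≤n
foldLength-mono (s≤s m≤n) = s≤s (+-mono-≤ (foldLength-mono m≤n) (foldLength-mono m≤n))

n≤foldLength : ∀ n → n ≤ foldLength n
n≤foldLength zero    = z≤n
n≤foldLength (suc n) = s≤s (≤-trans (n≤foldLength n) (m≤m+n _ _))

folding-suc-below : ∀ {m k} → k < foldLength m → folding (suc m) k ≡ folding m k
folding-suc-below {m} {k} k<N with <-cmp k (foldLength m)
... | tri< _ _ _   = refl
... | tri≈ k≮N _ _ = contradiction k<N k≮N
... | tri> k≮N _ _ = contradiction k<N k≮N

folding-suc-above : ∀ {m k} → foldLength m < k →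
  folding (suc m) k ≡ not (folding m (foldLength m + foldLength m ∸ k))
folding-suc-above {m} {k} N<k with <-cmp k (foldLength m)
... | tri< _ _ N≮k = contradiction N<k N≮k
... | tri≈ _ _ N≮k = contradiction N<k N≮k
... | tri> _ _ _   = refl

folding-stable : ∀ {m n k} → m ≤′ n → k < foldLength m → folding n k ≡ folding m k
folding-stable ≤′-refl        _   = refl
folding-stable (≤′-step m≤′n) k<N =
  trans (folding-suc-below (<-≤-trans k<N (foldLength-mono (≤′⇒≤ m≤′n)))) (folding-stable m≤′n k<N)

paperfolding-folding : ∀ {m k} → k < foldLength m → paperfolding k ≡ folding m k
paperfolding-folding {m} {k} k<N = begin
  folding (suc k) k       ≡⟨ folding-stable (≤⇒≤′ (m≤n⊔m m (suc k))) k<N[1+k] ⟨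
  folding (m ⊔ suc k) k   ≡⟨ folding-stable (≤⇒≤′ (m≤m⊔n m (suc k))) k<N ⟩
  folding m k             ∎
  where
  k<N[1+k] : k < foldLength (suc k)
  k<N[1+k] = s≤s (≤-trans (n≤foldLength k) (m≤m+n _ _))

paperfolding-mirror : ∀ {m k} → k < foldLength m →
  paperfolding (foldLength m + foldLength m ∸ k) ≡ not (paperfolding k)
paperfolding-mirror {m} {k} k<N = begin
  paperfolding j                ≡⟨ paperfolding-folding (s≤s (m∸n≤m (N + N) k)) ⟩
  folding (suc m) j             ≡⟨ folding-suc-above N<j ⟩
  not (folding m (N + N ∸ j))   ≡⟨ cong (not ∘ folding m) (m∸[m∸n]≡n (≤-trans (<⇒≤ k<N) (m≤m+n N N))) ⟩
  not (folding m k)             ≡⟨ cong not (paperfolding-folding k<N) ⟨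
  not (paperfolding k)          ∎
  where
  N = foldLength m
  j = N + N ∸ k
  N<j : N < j
  N<j = subst (N <_) (sym (+-∸-assoc N (<⇒≤ k<N))) (m<m+n N (m<n⇒0<n∸m k<N))

core : Bool → Vec A 12
core false = a ∷ a ∷ b ∷ b ∷ a ∷ b ∷ a ∷ a ∷ a ∷ b ∷ b ∷ a ∷ []
core true  = a ∷ b ∷ b ∷ a ∷ a ∷ a ∷ b ∷ a ∷ b ∷ b ∷ a ∷ a ∷ []

hinge : Bool → Vec A 2
hinge true  = a ∷ b ∷ []
hinge false = b ∷ a ∷ []

block : ℕ → Vec A 14
block k = core (odd k) ++ᵛ hinge (paperfolding k)

word : InfWord
word t = lookup (block (t / 14)) (t mod 14)

word-block : ∀ k i → word (k * 14 + toℕ i) ≡ lookup (block k) i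
word-block k i = cong₂ (λ q r → lookup (block q) r) ([k*n+i]/n≡k k i) ([k*n+i]mod-n≡i k i)

block-core : ∀ k i → lookup (block k) (i ↑ˡ 2) ≡ lookup (core (odd k)) i
block-core k = lookup-++ˡ (core (odd k)) (hinge (paperfolding k))

block-hinge : ∀ k i → lookup (block k) (12 ↑ʳ i) ≡ lookup (hinge (paperfolding k)) i
block-hinge k = lookup-++ʳ (core (odd k)) (hinge (paperfolding k))

IsReversalOf : ∀ {n} → Vec A n → Vec A n → Set
IsReversalOf {n} w v = ∀ (i : Fin n) → lookup w (opposite i) ≡ lookup v i

isReversalOf? : ∀ {n} (w v : Vec A n) → Dec (IsReversalOf w v)
isReversalOf? w v = all? λ i → lookup w (opposite i) ≟A lookup v i

core-reversal : ∀ e → IsReversalOf (core (not e)) (core e)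
core-reversal true  = from-yes (isReversalOf? (core false) (core true))
core-reversal false = from-yes (isReversalOf? (core true) (core false))

hinge-reversal : ∀ x → IsReversalOf (hinge (not x)) (hinge x)
hinge-reversal true  = from-yes (isReversalOf? (hinge false) (hinge true))
hinge-reversal false = from-yes (isReversalOf? (hinge true) (hinge false))

core-reflection : ∀ {M k} (i : Fin 12) → k ≤ M → odd M ≡ true →
  word (M * 14 + 11 ∸ (k * 14 + toℕ (i ↑ˡ 2))) ≡ word (k * 14 + toℕ (i ↑ˡ 2))
core-reflection {M} {k} i k≤M odd-M = begin
  word (M * 14 + 11 ∸ (k * 14 + toℕ (i ↑ˡ 2)))   ≡⟨ cong word (mirror-position 14 offsets k≤M) ⟩
  word ((M ∸ k) * 14 + toℕ (opposite i ↑ˡ 2))    ≡⟨ word-block (M ∸ k) (opposite i ↑ˡ 2) ⟩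
  lookup (block (M ∸ k)) (opposite i ↑ˡ 2)       ≡⟨ block-core (M ∸ k) (opposite i) ⟩
  lookup (core (odd (M ∸ k))) (opposite i)       ≡⟨ cong (λ e → lookup (core e) (opposite i)) parity ⟩
  lookup (core (not (odd k))) (opposite i)       ≡⟨ core-reversal (odd k) i ⟩
  lookup (core (odd k)) i                        ≡⟨ block-core k i ⟨
  lookup (block k) (i ↑ˡ 2)                      ≡⟨ word-block k (i ↑ˡ 2) ⟨
  word (k * 14 + toℕ (i ↑ˡ 2))                   ∎
  where
  offsets : toℕ (i ↑ˡ 2) + toℕ (opposite i ↑ˡ 2) ≡ 11
  offsets = trans (cong₂ _+_ (toℕ-↑ˡ i 2) (toℕ-↑ˡ (opposite i) 2)) (toℕ-+-opposite i)
  parity : odd (M ∸ k) ≡ not (odd k)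
  parity = trans (odd-∸ k≤M) (cong (_xor odd k) odd-M)

hinge-reflection : ∀ {m k} (i : Fin 2) → k < foldLength m →
  let M = foldLength m + foldLength m in
  word (M * 14 + 25 ∸ (k * 14 + toℕ (12 ↑ʳ i))) ≡ word (k * 14 + toℕ (12 ↑ʳ i))
hinge-reflection {m} {k} i k<N = begin
  word (M * 14 + 25 ∸ (k * 14 + toℕ (12 ↑ʳ i)))        ≡⟨ cong word (mirror-position 14 offsets k≤M) ⟩
  word ((M ∸ k) * 14 + toℕ (12 ↑ʳ opposite i))         ≡⟨ word-block (M ∸ k) (12 ↑ʳ opposite i) ⟩
  lookup (block (M ∸ k)) (12 ↑ʳ opposite i)            ≡⟨ block-hinge (M ∸ k) (opposite i) ⟩
  lookup (hinge (paperfolding (M ∸ k))) (opposite i)   ≡⟨ cong (λ x → lookup (hinge x) (opposite i))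
                                                            (paperfolding-mirror k<N) ⟩
  lookup (hinge (not (paperfolding k))) (opposite i)   ≡⟨ hinge-reversal (paperfolding k) i ⟩
  lookup (hinge (paperfolding k)) i                    ≡⟨ block-hinge k i ⟨
  lookup (block k) (12 ↑ʳ i)                           ≡⟨ word-block k (12 ↑ʳ i) ⟨
  word (k * 14 + toℕ (12 ↑ʳ i))                        ∎
  where
  M = foldLength m + foldLength m
  k≤M : k ≤ M
  k≤M = ≤-trans (<⇒≤ k<N) (m≤m+n _ _)
  offsets : toℕ (12 ↑ʳ i) + toℕ (12 ↑ʳ opposite i) ≡ 25
  offsets = begin
    toℕ (12 ↑ʳ i) + toℕ (12 ↑ʳ opposite i)   ≡⟨ cong₂ _+_ (toℕ-↑ʳ 12 i) (toℕ-↑ʳ 12 (opposite i)) ⟩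
    (12 + toℕ i) + (12 + toℕ (opposite i))   ≡⟨ interchange 12 (toℕ i) 12 _ ⟩
    24 + (toℕ i + toℕ (opposite i))          ≡⟨ cong (24 +_) (toℕ-+-opposite i) ⟩
    25                                       ∎

mirrorCentre : ℕ → ℕ
mirrorCentre m = foldLength (suc m) * 14 + 11

word-mirror : ∀ m t → t < foldLength m * 14 → word (mirrorCentre m ∸ t) ≡ word t
word-mirror m t t<14N =
  subst (λ t → word (mirrorCentre m ∸ t) ≡ word t) (sym (m≡[m/n]*n+m-mod-n t 14))
        (mirrorsAt-offset (t / 14) (t mod 14) (m<n*o⇒m/o<n t<14N))
  where
  N = foldLength m
  MirrorsAt : ℕ → Fin 14 → Set
  MirrorsAt k r = word (mirrorCentre m ∸ (k * 14 + toℕ r)) ≡ word (k * 14 + toℕ r)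
  centre≡ : (N + N) * 14 + 25 ≡ mirrorCentre m
  centre≡ = sym (trans (cong (_+ 11) (+-comm 14 ((N + N) * 14))) (+-assoc ((N + N) * 14) 14 11))
  mirrorsAt-offset : ∀ k r → k < N → MirrorsAt k r
  mirrorsAt-offset k r k<N with splitAt 12 r in eq
  ... | inj₁ i = subst (MirrorsAt k) (splitAt⁻¹-↑ˡ eq)
    (core-reflection i (≤-trans (<⇒≤ k<N) (foldLength-mono (n≤1+n m))) (cong not (odd-double N)))
  ... | inj₂ i = subst (MirrorsAt k) (splitAt⁻¹-↑ʳ eq)
    (subst (λ c → word (c ∸ (k * 14 + toℕ (12 ↑ʳ i))) ≡ word (k * 14 + toℕ (12 ↑ʳ i))) centre≡
           (hinge-reflection i k<N))

word-mirrors : ∀ m → ∃ λ c → m ≤ c × (∀ t → t < m → word (c ∸ t) ≡ word t)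
word-mirrors m = mirrorCentre m , m≤centre , λ t t<m → word-mirror m t (<-≤-trans t<m m≤14N)
  where
  m≤14N : m ≤ foldLength m * 14
  m≤14N = ≤-trans (n≤foldLength m) (m≤m*n _ 14)
  m≤centre : m ≤ mirrorCentre m
  m≤centre = ≤-trans m≤14N (≤-trans (*-monoˡ-≤ 14 (foldLength-mono (n≤1+n m))) (m≤m+n _ 11))

palindromes : List (List A)
palindromes =
  [] ∷ (b ∷ []) ∷ (a ∷ []) ∷ (a ∷ a ∷ []) ∷ (b ∷ b ∷ []) ∷ (b ∷ a ∷ b ∷ []) ∷ (a ∷ a ∷ a ∷ []) ∷
  (a ∷ b ∷ a ∷ []) ∷ (b ∷ a ∷ a ∷ b ∷ []) ∷ (a ∷ b ∷ b ∷ a ∷ []) ∷ (a ∷ a ∷ b ∷ a ∷ a ∷ []) ∷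
  (b ∷ a ∷ a ∷ a ∷ b ∷ []) ∷ (a ∷ a ∷ b ∷ b ∷ a ∷ a ∷ []) ∷ []

palindromes-short : All (λ v → 2 + length v ≤ 8) palindromes
palindromes-short = from-yes (All.all? (λ v → 2 + length v ≤? 8) palindromes)

PalindromicFactorsIn : List (List A) → ℕ → ℕ → List A → Set
PalindromicFactorsIn L p q w =
  ∀ {r} → r < p → ∀ {n} → n < q → Palindrome (take n (drop r w)) → take n (drop r w) ∈ L

palindromicFactorsIn? : ∀ L p q w → Dec (PalindromicFactorsIn L p q w)
palindromicFactorsIn? L p q w =
  allUpTo? (λ r → allUpTo? (λ n → palindrome? (take n (drop r w)) →-dec (take n (drop r w) ∈? L)) q) p

coreHingeCore : Bool → Bool → List A
coreHingeCore e x = toList (core e ++ᵛ hinge x) ++ toList (core (not e))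

window-coreHingeCore : ∀ k → window word (k * 14) 26 ≡ coreHingeCore (odd k) (paperfolding k)
window-coreHingeCore k = begin
  window word (k * 14) (14 + 12)                               ≡⟨ window-++ word (k * 14) 14 12 ⟩
  window word (k * 14) 14 ++ window word (k * 14 + 14) 12      ≡⟨ cong₂ _++_ this-block next-core ⟩
  coreHingeCore (odd k) (paperfolding k)                       ∎
  where
  this-block : window word (k * 14) 14 ≡ toList (block k)
  this-block = window-lookup word (k * 14) (block k) (word-block k)
  next-core : window word (k * 14 + 14) 12 ≡ toList (core (odd (suc k)))
  next-core = window-lookup word (k * 14 + 14) (core (odd (suc k))) λ i → begin
    word (k * 14 + 14 + toℕ i)              ≡⟨ cong (λ j → word (j + toℕ i)) (+-comm (k * 14) 14) ⟩
    word (suc k * 14 + toℕ i)               ≡⟨ cong (λ j → word (suc k * 14 + j)) (toℕ-↑ˡ i 2) ⟨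
    word (suc k * 14 + toℕ (i ↑ˡ 2))        ≡⟨ word-block (suc k) (i ↑ˡ 2) ⟩
    lookup (block (suc k)) (i ↑ˡ 2)         ≡⟨ block-core (suc k) i ⟩
    lookup (core (odd (suc k))) i           ∎

-- Windows of length at most 8 start inside a block and end before the next hinge.
coreHingeCore-palindromes : ∀ e x → PalindromicFactorsIn palindromes 14 9 (coreHingeCore e x)
coreHingeCore-palindromes true  true  = from-yes (palindromicFactorsIn? palindromes 14 9 (coreHingeCore true true))
coreHingeCore-palindromes true  false = from-yes (palindromicFactorsIn? palindromes 14 9 (coreHingeCore true false))
coreHingeCore-palindromes false true  = from-yes (palindromicFactorsIn? palindromes 14 9 (coreHingeCore false true))
coreHingeCore-palindromes false false = from-yes (palindromicFactorsIn? palindromes 14 9 (coreHingeCore false false))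

word-short-palindromes : ∀ t n → n ≤ 8 → Palindrome (window word t n) → window word t n ∈ palindromes
word-short-palindromes t n n≤8 pal =
  subst (_∈ palindromes) (sym t-window)
    (coreHingeCore-palindromes (odd k) (paperfolding k) (toℕ<n r) (s≤s n≤8) (subst Palindrome t-window pal))
  where
  k = t / 14
  r = t mod 14
  r+n≤26 : toℕ r + n ≤ 26
  r+n≤26 = +-mono-≤ (s≤s⁻¹ (toℕ<n r)) (≤-trans n≤8 (+-monoʳ-≤ 8 z≤n))
  t-window : window word t n ≡ take n (drop (toℕ r) (coreHingeCore (odd k) (paperfolding k)))
  t-window = begin
    window word t n                                 ≡⟨ cong (λ j → window word j n) (m≡[m/n]*n+m-mod-n t 14) ⟩
    window word (k * 14 + toℕ r) n                  ≡⟨ window-infix word (k * 14) (toℕ r) r+n≤26 ⟩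
    take n (drop (toℕ r) (window word (k * 14) 26)) ≡⟨ cong (take n ∘ drop (toℕ r)) (window-coreHingeCore k) ⟩
    take n (drop (toℕ r) (coreHingeCore (odd k) (paperfolding k)))   ∎

word-palindromes : ∀ i m → Palindrome (window word i m) → window word i m ∈ palindromes
word-palindromes = palindromes-from-short word palindromes 8 palindromes-short word-short-palindromes

mainTheorem13 : Σ InfWord λ ω → ClosedUnderReversal ω × PalCountAtMost ω 13
mainTheorem13 = word , closedUnderReversal word word-mirrors , palindromes , ≤-refl , palindromic-factors
  where
  palindromic-factors : ∀ u → Factor u word → Palindrome u → u ∈ palindromes
  palindromic-factors u (i , eq) pal =
    subst (_∈ palindromes) eq (word-palindromes i (length u) (subst Palindrome (sym eq) pal))
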